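{- Let $m,n$ be positive integers with $m \equiv 1 \pmod{16}$ and $n \equiv 1 \pmod{16}$. Then $K_m \Box K_n$ has an $L_8$-decomposition.
   Context: $K_m$ is the complete graph on $m$ vertices. The Cartesian product $G \Box H$ has vertex set $V(G)\times V(H)$, with $(g,h)$ adjacent to $(g',h')$ iff either $g=g'$ and $hh'\in E(H)$, or $h=h'$ and $gg'\in E(G)$. The sunlet graph $L_8$ is the graph on 8 vertices $x_1,\dots,x_8$ with edge set $\{x_1x_2,x_2x_3,x_3x_4,x_4x_1,x_1x_5,x_2x_6,x_3x_7,x_4x_8\}$. An $L_8$-decomposition of a graph $G$ is a partition of $E(G)$ into sets each inducing a subgraph isomorphic to $L_8$. -}

module Defs where

open import Data.Nat using (ℕ)
open import Data.Fin using (Fin; zero; suc)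
open import Data.Product using (Σ; _×_; _,_; proj₁; proj₂)
open import Data.Sum using (_⊎_)
open import Data.Vec using (Vec; lookup; []; _∷_)
open import Relation.Binary.PropositionalEquality using (_≡_; _≢_)
open import Relation.Nullary using (¬_)
open import Function.Definitions using (Injective)
open import Level using (0ℓ)

record Graph (V : Set) : Set₁ where
  field
    Adj   : V → V → Set
    sym   : ∀ {u v} → Adj u v → Adj v u
    irrefl : ∀ {u} → ¬ Adj u u
open Graph public

K : (m : ℕ) → Graph (Fin m)
K m = record { Adj = λ u v → u ≢ v
             ; sym = λ u≢v v≡u → u≢v (Relation.Binary.PropositionalEquality.sym v≡u)
             ; irrefl = λ u≢u → u≢u Relation.Binary.PropositionalEquality.refl }

_□_ : {A B : Set} → Graph A → Graph B → Graph (A × B)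
_□_ {A} {B} G H = record
  { Adj = adj
  ; sym = sy
  ; irrefl = ir }
  where
  open Relation.Binary.PropositionalEquality using (refl)
  adj : A × B → A × B → Set
  adj (g , h) (g' , h') = (g ≡ g' × Adj H h h') ⊎ (h ≡ h' × Adj G g g')
  sy : ∀ {u v} → adj u v → adj v u
  sy (Data.Sum.inj₁ (refl , a)) = Data.Sum.inj₁ (refl , Graph.sym H a)
  sy (Data.Sum.inj₂ (refl , a)) = Data.Sum.inj₂ (refl , Graph.sym G a)
  ir : ∀ {u} → ¬ adj u u
  ir (Data.Sum.inj₁ (_ , a)) = Graph.irrefl H a
  ir (Data.Sum.inj₂ (_ , a)) = Graph.irrefl G a

-- Sunlet graph L_8: vertices x1..x8 are Fin 8 indices 0..7; its 8 edges
-- x1x2, x2x3, x3x4, x4x1, x1x5, x2x6, x3x7, x4x8 (each as an ordered pair).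
L8-edges : Vec (Fin 8 × Fin 8) 8
L8-edges = (x1 , x2) ∷ (x2 , x3) ∷ (x3 , x4) ∷ (x4 , x1)
         ∷ (x1 , x5) ∷ (x2 , x6) ∷ (x3 , x7) ∷ (x4 , x8) ∷ []
  where
  x1 x2 x3 x4 x5 x6 x7 x8 : Fin 8
  x1 = zero
  x2 = suc zero
  x3 = suc (suc zero)
  x4 = suc (suc (suc zero))
  x5 = suc (suc (suc (suc zero)))
  x6 = suc (suc (suc (suc (suc zero))))
  x7 = suc (suc (suc (suc (suc (suc zero)))))
  x8 = suc (suc (suc (suc (suc (suc (suc zero))))))

L8-edge : Fin 8 → Fin 8 × Fin 8
L8-edge e = lookup L8-edges e

-- A copy of L_8 in G: an injective vertex map sending every L_8 edge to an
-- edge of G.  Its edge set is the image of the L_8 edges, and the subgraph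
-- it forms is isomorphic to L_8.
record L8Copy {V : Set} (G : Graph V) : Set where
  field
    vmap  : Fin 8 → V
    inj   : Injective _≡_ _≡_ vmap
    edges : ∀ (e : Fin 8) → Adj G (vmap (proj₁ (L8-edge e))) (vmap (proj₂ (L8-edge e)))
open L8Copy public

Covers : {V : Set} {G : Graph V} → L8Copy G → Fin 8 → V → V → Set
Covers c e u v =
  (vmap c (proj₁ (L8-edge e)) ≡ u × vmap c (proj₂ (L8-edge e)) ≡ v)
  ⊎ (vmap c (proj₁ (L8-edge e)) ≡ v × vmap c (proj₂ (L8-edge e)) ≡ u)

-- Since all edges of the copies are edges of G, this partitions E(G).
record L8Decomposition {V : Set} (G : Graph V) : Set where
  field
    k      : ℕ
    copies : Fin k → L8Copy G
    unique : ∀ u v → Adj G u v →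
             Σ (Fin k × Fin 8) λ p → Covers (copies (proj₁ p)) (proj₂ p) u v
               × (∀ q → Covers (copies (proj₁ q)) (proj₂ q) u v → q ≡ p)

module Submission where

-- A family of blocks b : Fin 8 → V (candidate copies of L8, indexed by the
-- vertices x1..x8) is handled through its multiplicity function: the number of
-- pairs (block, L8-edge) that land on a given unordered pair {u , v}.  A
-- "design" for an edge indicator χ : V → V → ℕ is a list of injective blocks
-- whose multiplicity is exactly χ.  Designs behave like edge sets: they can be
-- pushed along embeddings of vertex types, and designs for edge-disjoint
-- graphs can be united.  A design for the edge indicator of a graph G yields
-- an L8-decomposition of G.
--
-- The two base designs, for K_17 (translates of one block modulo 17) and for
-- K_{16,16} (translates of two blocks modulo 16), are verified by computation.
-- Writing K_{1+16s} as the cone over s groups of 16 points, the identities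
--   K_{16(s+1),16} = K_{16s,16} ∪ K_{16,16},
--   K_{1+16(s+1)}  = K_{1+16s} ∪ K_17 ∪ K_{16s,16}
-- give designs for every K_{1+16s} by induction on s.  Finally K_m □ K_n is
-- the edge-disjoint union of its rows (copies of K_m) and columns (copies of
-- K_n), so designs for K_m and K_n combine into one for K_m □ K_n.

open import Defs using (Graph; Adj; K; _□_; L8-edge; L8Copy; Covers; L8Decomposition)
open import Data.Bool using (if_then_else_)
open import Data.Empty using (⊥-elim)
open import Data.Fin as F using (Fin; zero; suc)
open import Data.Fin.Properties using (all?; +↔⊎; 1↔⊤)
import Data.Fin.Properties as Fin
open import Data.List using (List; []; _∷_; _++_; map; length; lookup; upTo)
open import Data.List.Properties using (map-++)
open import Data.List.Membership.Propositional.Properties using (∈-lookup)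
open import Data.List.Relation.Unary.All as All using (All; []; _∷_)
open import Data.List.Relation.Unary.All.Properties using (map⁺; ++⁺)
open import Data.Maybe as Maybe using (Maybe; just; nothing)
open import Data.Maybe.Properties using (just-injective)
open import Data.Nat using (ℕ; zero; suc; _+_; _*_; _%_; _/_; NonZero)
open import Data.Nat.DivMod using (_mod_; m≡m%n+[m/n]*n)
import Data.Nat.ListAction as List
open import Data.Nat.ListAction.Properties using (sum-++)
open import Data.Nat.Properties as ℕ using (+-0-monoid; +-identityʳ; m+n≡0⇒m≡0; m+n≡0⇒n≡0; 1+n≢0)
open import Data.Product using (Σ; Σ-syntax; _×_; _,_; swap)
import Data.Product as Product
open import Data.Product.Properties using () renaming (≡-dec to _×≟_)
open import Data.Sum using (_⊎_; inj₁; inj₂)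
import Data.Sum as Sum
open import Data.Sum.Function.Propositional using (_⊎-↔_)
open import Data.Sum.Properties using (swap-↔) renaming (≡-dec to _⊎≟_)
open import Data.Unit using (⊤; tt)
import Data.Unit.Properties as Unit
open import Data.Vec using (Vec; []; _∷_)
import Data.Vec as Vec
open import Function using (_∘_; id; _⇔_; mk⇔; _↔_; Inverse)
open import Function.Properties.Inverse using (↔-refl; ↔-sym; ↔-trans)
open import Relation.Binary.Definitions using (DecidableEquality)
open import Relation.Binary.PropositionalEquality
open import Relation.Nullary using (Dec; yes; no; ¬_; does; ¬?)
open import Relation.Nullary.Decidable using (_×-dec_; _⊎-dec_; _→-dec_; toWitness; toSum; dec-true; dec-false; does-⇔)

open import Algebra.Properties.Monoid.Sum +-0-monoid
  using (sum; sum-syntax; sum-cong-≗; sum-replicate-zero)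

sum-zero : ∀ {n} (f : Fin n → ℕ) → (∀ i → f i ≡ 0) → sum f ≡ 0
sum-zero {n} f f≡0 = trans (sum-cong-≗ f≡0) (sum-replicate-zero n)

sum-zero⁻ : ∀ {n} (f : Fin n → ℕ) → sum f ≡ 0 → ∀ i → f i ≡ 0
sum-zero⁻ f Σ≡0 zero    = m+n≡0⇒m≡0 (f zero) Σ≡0
sum-zero⁻ f Σ≡0 (suc i) = sum-zero⁻ (f ∘ suc) (m+n≡0⇒n≡0 (f zero) Σ≡0) i

sum-delta : ∀ {n} (f : Fin n → ℕ) (i : Fin n) → (∀ j → j ≢ i → f j ≡ 0) → sum f ≡ f i
sum-delta f zero    off = trans (cong (f zero +_) (sum-zero (f ∘ suc) (λ j → off (suc j) λ ()))) (+-identityʳ (f zero))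
sum-delta f (suc i) off = trans (cong (_+ sum (f ∘ suc)) (off zero λ ()))
                                (sum-delta (f ∘ suc) i (λ j j≢i → off (suc j) (j≢i ∘ Fin.suc-injective)))

sum≢0 : ∀ {n} (f : Fin n → ℕ) → sum f ≢ 0 → Σ[ i ∈ Fin n ] f i ≢ 0
sum≢0 {zero}  f Σ≢0 = ⊥-elim (Σ≢0 refl)
sum≢0 {suc n} f Σ≢0 with f zero in f₀
... | suc _ = zero , λ f₀≡0 → 1+n≢0 (trans (sym f₀) f₀≡0)
... | zero  = Product.map suc id (sum≢0 (f ∘ suc) Σ≢0)

single-term : ∀ {n} (f : Fin n → ℕ) → sum f ≡ 1 →
              Σ[ i ∈ Fin n ] (f i ≡ 1 × ∀ j → f j ≢ 0 → j ≡ i)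
single-term {suc n} f Σ≡1 with f zero in f₀
... | zero =
  let (i , fi≡1 , only-i) = single-term (f ∘ suc) Σ≡1
  in  suc i , fi≡1 , λ { zero f₀≢0 → ⊥-elim (f₀≢0 f₀) ; (suc j) fj≢0 → cong suc (only-i j fj≢0) }
... | suc zero =
  zero , f₀ , λ { zero _ → refl ; (suc j) fj≢0 → ⊥-elim (fj≢0 (sum-zero⁻ (f ∘ suc) (ℕ.suc-injective Σ≡1) j)) }

+≢0 : ∀ {m n} → m + n ≢ 0 → m ≢ 0 ⊎ n ≢ 0
+≢0 {zero}  n≢0 = inj₂ n≢0
+≢0 {suc m} _   = inj₁ λ ()

sum-lookup : {A : Set} (f : A → ℕ) (L : List A) → List.sum (map f L) ≡ ∑[ i < length L ] f (lookup L i)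
sum-lookup f []      = refl
sum-lookup f (x ∷ L) = cong (f x +_) (sum-lookup f L)

indicator : {P : Set} → Dec P → ℕ
indicator P? = if does P? then 1 else 0

indicator-yes : {P : Set} (P? : Dec P) → P → indicator P? ≡ 1
indicator-yes P? p = cong (if_then 1 else 0) (dec-true P? p)

indicator-no : {P : Set} (P? : Dec P) → ¬ P → indicator P? ≡ 0
indicator-no P? ¬p = cong (if_then 1 else 0) (dec-false P? ¬p)

indicator-sound : {P : Set} (P? : Dec P) → indicator P? ≢ 0 → P
indicator-sound (yes p) _   = p
indicator-sound (no _)  ≢0 = ⊥-elim (≢0 refl)

indicator-⇔ : {P Q : Set} → P ⇔ Q → (P? : Dec P) (Q? : Dec Q) → indicator P? ≡ indicator Q?
indicator-⇔ P⇔Q P? Q? = cong (if_then 1 else 0) (does-⇔ P⇔Q P? Q?)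

Block : Set → Set
Block V = Fin 8 → V

src tgt : Fin 8 → Fin 8
src e = Product.proj₁ (L8-edge e)
tgt e = Product.proj₂ (L8-edge e)

-- The L8-edge e of block b lands on the unordered pair {u , v}; this is the
-- relation Covers of Defs, for blocks not yet packaged as copies.
PlacesOn : {V : Set} → Block V → Fin 8 → V → V → Set
PlacesOn b e u v = (b (src e) ≡ u × b (tgt e) ≡ v) ⊎ (b (src e) ≡ v × b (tgt e) ≡ u)

InjectiveBlock : {V : Set} → Block V → Set
InjectiveBlock b = ∀ i j → b i ≡ b j → i ≡ j

bipartite : {A B : Set} → A ⊎ B → A ⊎ B → ℕ
bipartite (inj₁ _) (inj₂ _) = 1
bipartite (inj₂ _) (inj₁ _) = 1
bipartite _        _        = 0

bipartite-sym : {A B : Set} (u v : A ⊎ B) → bipartite u v ≡ bipartite v u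
bipartite-sym (inj₁ _) (inj₁ _) = refl
bipartite-sym (inj₁ _) (inj₂ _) = refl
bipartite-sym (inj₂ _) (inj₁ _) = refl
bipartite-sym (inj₂ _) (inj₂ _) = refl

module _ {V : Set} (_≟_ : DecidableEquality V) where

  places? : (b : Block V) (e : Fin 8) (u v : V) → Dec (PlacesOn b e u v)
  places? b e u v = (b (src e) ≟ u ×-dec b (tgt e) ≟ v) ⊎-dec (b (src e) ≟ v ×-dec b (tgt e) ≟ u)

  blockMultiplicity : Block V → V → V → ℕ
  blockMultiplicity b u v = ∑[ e < 8 ] indicator (places? b e u v)

  multiplicity : List (Block V) → V → V → ℕ
  multiplicity L u v = List.sum (map (λ b → blockMultiplicity b u v) L)

  multiplicity-++ : ∀ L M u v → multiplicity (L ++ M) u v ≡ multiplicity L u v + multiplicity M u v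
  multiplicity-++ L M u v = trans (cong List.sum (map-++ f L M)) (sum-++ (map f L) (map f M))
    where f : Block V → ℕ
          f b = blockMultiplicity b u v

  -- Edge indicator of the complete graph on V.
  distinct : V → V → ℕ
  distinct u v = indicator (¬? (u ≟ v))

  injective? : (b : Block V) → Dec (InjectiveBlock b)
  injective? b = all? λ i → all? λ j → b i ≟ b j →-dec i F.≟ j

  multiplicity-sym : ∀ L u v → multiplicity L u v ≡ multiplicity L v u
  multiplicity-sym []      u v = refl
  multiplicity-sym (b ∷ L) u v =
    cong₂ _+_ (sum-cong-≗ λ e → indicator-⇔ (mk⇔ Sum.swap Sum.swap) (places? b e u v) (places? b e v u))
              (multiplicity-sym L u v)

  multiplicity-off : {χ : V → V → ℕ} → (∀ u v → χ u v ≡ χ v u) →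
                     ∀ {L} → All (λ b → ∀ e → χ (b (src e)) (b (tgt e)) ≢ 0) L →
                     ∀ {u v} → χ u v ≡ 0 → multiplicity L u v ≡ 0
  multiplicity-off χ-sym []                          χ≡0 = refl
  multiplicity-off {χ} χ-sym {b ∷ _} (in-χ ∷ in-χs) {u} {v} χ≡0 =
    cong₂ _+_ (sum-zero _ λ e → indicator-no (places? b e u v) (not-placed e))
              (multiplicity-off χ-sym in-χs χ≡0)
    where
    not-placed : ∀ e → ¬ PlacesOn b e u v
    not-placed e (inj₁ (p , q)) = in-χ e (trans (cong₂ χ p q) χ≡0)
    not-placed e (inj₂ (p , q)) = in-χ e (trans (cong₂ χ p q) (trans (χ-sym v u) χ≡0))

record Design {V : Set} (_≟_ : DecidableEquality V) (χ : V → V → ℕ) : Set where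
  field
    blocks    : List (Block V)
    injective : All InjectiveBlock blocks
    exact     : ∀ u v → multiplicity _≟_ blocks u v ≡ χ u v
open Design

module _ {V : Set} {_≟_ : DecidableEquality V} where

  edgeless : {χ : V → V → ℕ} → (∀ u v → χ u v ≡ 0) → Design _≟_ χ
  edgeless χ≡0 = record { blocks = [] ; injective = [] ; exact = λ u v → sym (χ≡0 u v) }

  design-cong : {χ ψ : V → V → ℕ} → (∀ u v → χ u v ≡ ψ u v) → Design _≟_ χ → Design _≟_ ψ
  design-cong χ≡ψ D = record { blocks = blocks D ; injective = injective D
                             ; exact = λ u v → trans (exact D u v) (χ≡ψ u v) }

  design-union : {χ ψ : V → V → ℕ} → Design _≟_ χ → Design _≟_ ψ → Design _≟_ (λ u v → χ u v + ψ u v)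
  design-union D E = record
    { blocks    = blocks D ++ blocks E
    ; injective = ++⁺ (injective D) (injective E)
    ; exact     = λ u v → trans (multiplicity-++ _≟_ (blocks D) (blocks E) u v)
                                (cong₂ _+_ (exact D u v) (exact E u v)) }

  design-⋃ : ∀ {n} {χ : Fin n → V → V → ℕ} → (∀ i → Design _≟_ (χ i)) →
             Design _≟_ (λ u v → ∑[ i < n ] χ i u v)
  design-⋃ {zero}  D = edgeless λ _ _ → refl
  design-⋃ {suc n} D = design-union (D zero) (design-⋃ (D ∘ suc))

record Embedding (A V : Set) : Set where
  field
    to      : A → V
    from    : V → Maybe A
    from-to : ∀ x → from (to x) ≡ just x
    to-from : ∀ {v x} → from v ≡ just x → to x ≡ v

  to-injective : ∀ {x y} → to x ≡ to y → x ≡ y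
  to-injective {x} {y} eq = just-injective (trans (sym (from-to x)) (trans (cong from eq) (from-to y)))

  outside : ∀ {u x} → from u ≡ nothing → to x ≢ u
  outside {x = x} fu refl with trans (sym (from-to x)) fu
  ... | ()
open Embedding

restrict : {A : Set} → (A → A → ℕ) → Maybe A → Maybe A → ℕ
restrict χ (just x) (just y) = χ x y
restrict χ _        _        = 0

push : {A V : Set} → Embedding A V → (A → A → ℕ) → V → V → ℕ
push e χ u v = restrict χ (from e u) (from e v)

module _ {A : Set} where

  restrict-nothingʳ : (χ : A → A → ℕ) (m : Maybe A) → restrict χ m nothing ≡ 0
  restrict-nothingʳ χ (just _) = refl
  restrict-nothingʳ χ nothing  = refl

  restrict-cong : {χ ψ : A → A → ℕ} → (∀ x y → χ x y ≡ ψ x y) → ∀ m m' → restrict χ m m' ≡ restrict ψ m m'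
  restrict-cong χ≡ψ (just x) (just y) = χ≡ψ x y
  restrict-cong χ≡ψ (just _) nothing  = refl
  restrict-cong χ≡ψ nothing  _        = refl

  restrict-+ : (χ ψ : A → A → ℕ) → ∀ m m' →
               restrict (λ x y → χ x y + ψ x y) m m' ≡ restrict χ m m' + restrict ψ m m'
  restrict-+ χ ψ (just x) (just y) = refl
  restrict-+ χ ψ (just _) nothing  = refl
  restrict-+ χ ψ nothing  _        = refl

module _ {A V : Set} (e : Embedding A V) {χ : A → A → ℕ} where

  push-to : ∀ x y → push e χ (to e x) (to e y) ≡ χ x y
  push-to x y rewrite from-to e x | from-to e y = refl

  push-offˡ : ∀ {u v} → from e u ≡ nothing → push e χ u v ≡ 0
  push-offˡ fu rewrite fu = refl

  push-offʳ : ∀ {u v} → from e v ≡ nothing → push e χ u v ≡ 0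
  push-offʳ {u} fv rewrite fv = restrict-nothingʳ χ (from e u)

  push-support : ∀ {u v} → push e χ u v ≢ 0 → Σ[ x ∈ A ] Σ[ y ∈ A ] (to e x ≡ u × to e y ≡ v × χ x y ≢ 0)
  push-support {u} {v} ≢0 with from e u in fu | from e v in fv
  ... | just x  | just y  = x , y , to-from e fu , to-from e fv , ≢0
  ... | just _  | nothing = ⊥-elim (≢0 refl)
  ... | nothing | _       = ⊥-elim (≢0 refl)

module _ {A V : Set} (_≟ᴬ_ : DecidableEquality A) (_≟ⱽ_ : DecidableEquality V) (e : Embedding A V) where

  image : List (Block A) → List (Block V)
  image = map (to e ∘_)

  places-to : ∀ b ε x y → PlacesOn (to e ∘ b) ε (to e x) (to e y) ⇔ PlacesOn b ε x y
  places-to b ε x y = mk⇔ (Sum.map (Product.map cancel cancel) (Product.map cancel cancel))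
                          (Sum.map (Product.map (cong (to e)) (cong (to e))) (Product.map (cong (to e)) (cong (to e))))
    where cancel : ∀ {x y} → to e x ≡ to e y → x ≡ y
          cancel = to-injective e

  places-outside : ∀ b ε {u v} → from e u ≡ nothing ⊎ from e v ≡ nothing → ¬ PlacesOn (to e ∘ b) ε u v
  places-outside b ε (inj₁ fu) (inj₁ (p , _)) = outside e fu p
  places-outside b ε (inj₁ fu) (inj₂ (_ , q)) = outside e fu q
  places-outside b ε (inj₂ fv) (inj₁ (_ , q)) = outside e fv q
  places-outside b ε (inj₂ fv) (inj₂ (p , _)) = outside e fv p

  private
    placesⱽ : ∀ b ε u v → Dec (PlacesOn (to e ∘ b) ε u v)
    placesⱽ b = places? _≟ⱽ_ (to e ∘ b)

  block-image : ∀ b u v → blockMultiplicity _≟ⱽ_ (to e ∘ b) u v ≡ restrict (blockMultiplicity _≟ᴬ_ b) (from e u) (from e v)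
  block-image b u v with from e u in fu | from e v in fv
  ... | just x | just y with to-from e fu | to-from e fv
  ...   | refl | refl = sum-cong-≗ λ ε → indicator-⇔ (places-to b ε x y) (placesⱽ b ε _ _) (places? _≟ᴬ_ b ε x y)
  block-image b u v | just _ | nothing =
    sum-zero _ λ ε → indicator-no (placesⱽ b ε u v) (places-outside b ε (inj₂ fv))
  block-image b u v | nothing | _ =
    sum-zero _ λ ε → indicator-no (placesⱽ b ε u v) (places-outside b ε (inj₁ fu))

  multiplicity-image : ∀ L u v → multiplicity _≟ⱽ_ (image L) u v ≡ restrict (multiplicity _≟ᴬ_ L) (from e u) (from e v)
  multiplicity-image [] u v = sym (restrict-zero (from e u) (from e v))
    where restrict-zero : ∀ m m' → restrict {A} (λ _ _ → 0) m m' ≡ 0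
          restrict-zero (just _) (just _) = refl
          restrict-zero (just _) nothing  = refl
          restrict-zero nothing  _        = refl
  multiplicity-image (b ∷ L) u v =
    trans (cong₂ _+_ (block-image b u v) (multiplicity-image L u v))
          (sym (restrict-+ (blockMultiplicity _≟ᴬ_ b) (multiplicity _≟ᴬ_ L) (from e u) (from e v)))

  design-image : {χ : A → A → ℕ} → Design _≟ᴬ_ χ → Design _≟ⱽ_ (push e χ)
  design-image D = record
    { blocks    = image (blocks D)
    ; injective = map⁺ (All.map (λ inj i j eq → inj i j (to-injective e eq)) (injective D))
    ; exact     = λ u v → trans (multiplicity-image (blocks D) u v) (restrict-cong (exact D) (from e u) (from e v)) }

id-embedding : {A : Set} → Embedding A A
id-embedding = record { to = id ; from = just ; from-to = λ _ → refl ; to-from = λ { refl → refl } }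

module _ {A B : Set} where

  inj₁-embedding : Embedding A (A ⊎ B)
  inj₁-embedding = record { to = inj₁ ; from = Sum.[ just , (λ _ → nothing) ]′
                          ; from-to = λ _ → refl ; to-from = to-from₁ }
    where to-from₁ : ∀ {v x} → Sum.[ just , (λ _ → nothing) ]′ v ≡ just x → inj₁ x ≡ v
          to-from₁ {inj₁ _} refl = refl

  inj₂-embedding : Embedding B (A ⊎ B)
  inj₂-embedding = record { to = inj₂ ; from = Sum.[ (λ _ → nothing) , just ]′
                          ; from-to = λ _ → refl ; to-from = to-from₂ }
    where to-from₂ : ∀ {v x} → Sum.[ (λ _ → nothing) , just ]′ v ≡ just x → inj₂ x ≡ v
          to-from₂ {inj₂ _} refl = refl

module _ {A B C D : Set} (e₁ : Embedding A C) (e₂ : Embedding B D) where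

  private
    from⊎ : C ⊎ D → Maybe (A ⊎ B)
    from⊎ (inj₁ c) = Maybe.map inj₁ (from e₁ c)
    from⊎ (inj₂ d) = Maybe.map inj₂ (from e₂ d)

    to-from⊎ : ∀ {v x} → from⊎ v ≡ just x → Sum.map (to e₁) (to e₂) x ≡ v
    to-from⊎ {inj₁ c} eq with from e₁ c in fc
    to-from⊎ {inj₁ c} refl | just _ = cong inj₁ (to-from e₁ fc)
    to-from⊎ {inj₂ d} eq with from e₂ d in fd
    to-from⊎ {inj₂ d} refl | just _ = cong inj₂ (to-from e₂ fd)

  _⊎-embedding_ : Embedding (A ⊎ B) (C ⊎ D)
  _⊎-embedding_ = record
    { to      = Sum.map (to e₁) (to e₂)
    ; from    = from⊎
    ; from-to = Sum.[ cong (Maybe.map inj₁) ∘ from-to e₁ , cong (Maybe.map inj₂) ∘ from-to e₂ ]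
    ; to-from = to-from⊎ }

_≟⊤_ : DecidableEquality ⊤
_≟⊤_ = Unit._≟_

module _ {W A C : Set} (_≟ᵂ_ : DecidableEquality W) (_≟ᴬ_ : DecidableEquality A) (_≟ᶜ_ : DecidableEquality C) where

  private
    _≟_ : DecidableEquality ((W ⊎ A) ⊎ C)
    _≟_ = (_≟ᵂ_ ⊎≟ _≟ᴬ_) ⊎≟ _≟ᶜ_
    old new : Embedding _ ((W ⊎ A) ⊎ C)
    old = inj₁-embedding ⊎-embedding id-embedding
    new = inj₂-embedding ⊎-embedding id-embedding

  -- K_{W ⊎ A, C} is the edge-disjoint union of K_{W,C} and K_{A,C}.
  bipartite-split : ∀ u v → push old bipartite u v + push new bipartite u v ≡ bipartite u v
  bipartite-split (inj₁ (inj₁ _)) (inj₁ (inj₁ _)) = refl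
  bipartite-split (inj₁ (inj₁ _)) (inj₁ (inj₂ _)) = refl
  bipartite-split (inj₁ (inj₁ _)) (inj₂ _)        = refl
  bipartite-split (inj₁ (inj₂ _)) (inj₁ (inj₁ _)) = refl
  bipartite-split (inj₁ (inj₂ _)) (inj₁ (inj₂ _)) = refl
  bipartite-split (inj₁ (inj₂ _)) (inj₂ _)        = refl
  bipartite-split (inj₂ _)        (inj₁ (inj₁ _)) = refl
  bipartite-split (inj₂ _)        (inj₁ (inj₂ _)) = refl
  bipartite-split (inj₂ _)        (inj₂ _)        = refl

  bipartite-join : Design (_≟ᵂ_ ⊎≟ _≟ᶜ_) bipartite → Design (_≟ᴬ_ ⊎≟ _≟ᶜ_) bipartite → Design _≟_ bipartite
  bipartite-join DW DA =
    design-cong bipartite-split (design-union (design-image _ _≟_ old DW) (design-image _ _≟_ new DA))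

module _ {W A : Set} (_≟ᵂ_ : DecidableEquality W) (_≟ᴬ_ : DecidableEquality A) where

  private
    _≟_ : DecidableEquality (⊤ ⊎ (W ⊎ A))
    _≟_ = _≟⊤_ ⊎≟ (_≟ᵂ_ ⊎≟ _≟ᴬ_)
    cone-old : Embedding (⊤ ⊎ W) (⊤ ⊎ (W ⊎ A))
    cone-old = id-embedding ⊎-embedding inj₁-embedding
    cone-new : Embedding (⊤ ⊎ A) (⊤ ⊎ (W ⊎ A))
    cone-new = id-embedding ⊎-embedding inj₂-embedding
    bridge : Embedding (W ⊎ A) (⊤ ⊎ (W ⊎ A))
    bridge = inj₂-embedding

  -- With an apex ∞, K_{∞ ⊎ W ⊎ A} is the edge-disjoint union of the cones
  -- K_{∞ ⊎ W} and K_{∞ ⊎ A} and the bipartite graph K_{W,A}.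
  cone-split : ∀ u v → push cone-old (distinct (_≟⊤_ ⊎≟ _≟ᵂ_)) u v
                       + (push cone-new (distinct (_≟⊤_ ⊎≟ _≟ᴬ_)) u v + push bridge bipartite u v)
                       ≡ distinct _≟_ u v
  cone-split (inj₁ _)        (inj₁ _)        = refl
  cone-split (inj₁ _)        (inj₂ (inj₁ _)) = refl
  cone-split (inj₁ _)        (inj₂ (inj₂ _)) = refl
  cone-split (inj₂ (inj₁ _)) (inj₁ _)        = refl
  cone-split (inj₂ (inj₁ w)) (inj₂ (inj₁ x)) = +-identityʳ (distinct _≟ᵂ_ w x)
  cone-split (inj₂ (inj₁ _)) (inj₂ (inj₂ _)) = refl
  cone-split (inj₂ (inj₂ _)) (inj₁ _)        = refl
  cone-split (inj₂ (inj₂ _)) (inj₂ (inj₁ _)) = refl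
  cone-split (inj₂ (inj₂ a)) (inj₂ (inj₂ b)) = +-identityʳ (distinct _≟ᴬ_ a b)

  cone-join : Design (_≟⊤_ ⊎≟ _≟ᵂ_) (distinct (_≟⊤_ ⊎≟ _≟ᵂ_)) →
              Design (_≟⊤_ ⊎≟ _≟ᴬ_) (distinct (_≟⊤_ ⊎≟ _≟ᴬ_)) →
              Design (_≟ᵂ_ ⊎≟ _≟ᴬ_) bipartite →
              Design _≟_ (distinct _≟_)
  cone-join DW DA DWA = design-cong cone-split
    (design-union (design-image _ _≟_ cone-old DW)
      (design-union (design-image _ _≟_ cone-new DA) (design-image _ _≟_ bridge DWA)))

complete-transport : {A V : Set} {_≟ᴬ_ : DecidableEquality A} {_≟ⱽ_ : DecidableEquality V} →
                     A ↔ V → Design _≟ᴬ_ (distinct _≟ᴬ_) → Design _≟ⱽ_ (distinct _≟ⱽ_)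
complete-transport {_≟ᴬ_ = _≟ᴬ_} {_≟ⱽ_} A↔V D =
  design-cong distinct-along (design-image _≟ᴬ_ _≟ⱽ_ bijection D)
  where
  open Inverse A↔V using (strictlyInverseˡ; strictlyInverseʳ) renaming (to to f; from to f⁻¹)
  bijection : Embedding _ _
  bijection = record { to = f ; from = just ∘ f⁻¹ ; from-to = cong just ∘ strictlyInverseʳ
                     ; to-from = λ { {v} refl → strictlyInverseˡ v } }
  f⁻¹-injective : ∀ {u v} → f⁻¹ u ≡ f⁻¹ v → u ≡ v
  f⁻¹-injective {u} {v} eq = trans (sym (strictlyInverseˡ u)) (trans (cong f eq) (strictlyInverseˡ v))
  distinct-along : ∀ u v → distinct _≟ᴬ_ (f⁻¹ u) (f⁻¹ v) ≡ distinct _≟ⱽ_ u v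
  distinct-along u v = indicator-⇔ (mk⇔ (λ ne → ne ∘ cong f⁻¹) (λ ne eq → ne (f⁻¹-injective eq)))
                                   (¬? (f⁻¹ u ≟ᴬ f⁻¹ v)) (¬? (u ≟ⱽ v))

translate : (n : ℕ) .{{_ : NonZero n}} → ℕ → ℕ → Fin n
translate n i a = (i + a) mod n

K17-blocks : List (Block (Fin 17))
K17-blocks = map (λ i x → translate 17 i (Vec.lookup base x)) (upTo 17)
  where base : Vec ℕ 8
        base = 0 ∷ 1 ∷ 3 ∷ 6 ∷ 4 ∷ 8 ∷ 12 ∷ 11 ∷ []

K17-design : Design F._≟_ (distinct F._≟_)
K17-design = record
  { blocks    = K17-blocks
  ; injective = toWitness {a? = All.all? (injective? F._≟_) K17-blocks} tt
  ; exact     = toWitness {a? = all? λ x → all? λ y →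
                  multiplicity F._≟_ K17-blocks x y ℕ.≟ distinct F._≟_ x y} tt }

K16,16-blocks : List (Block (Fin 16 ⊎ Fin 16))
K16,16-blocks = develop (inj₁ 1 ∷ inj₂ 2 ∷ inj₁ 2 ∷ inj₂ 0 ∷ inj₂ 14 ∷ inj₁ 0 ∷ inj₂ 8 ∷ inj₁ 7 ∷ [])
             ++ develop (inj₁ 0 ∷ inj₂ 4 ∷ inj₁ 1 ∷ inj₂ 11 ∷ inj₂ 5 ∷ inj₁ 12 ∷ inj₂ 13 ∷ inj₁ 4 ∷ [])
  where develop : Vec (ℕ ⊎ ℕ) 8 → List (Block (Fin 16 ⊎ Fin 16))
        develop base = map (λ i x → Sum.map (translate 16 i) (translate 16 i) (Vec.lookup base x)) (upTo 16)

K16,16-design : Design (F._≟_ ⊎≟ F._≟_) bipartite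
K16,16-design = record
  { blocks    = K16,16-blocks
  ; injective = toWitness {a? = All.all? (injective? _≟_) K16,16-blocks} tt
  ; exact     = exact-K16,16 }
  where
  _≟_ : DecidableEquality (Fin 16 ⊎ Fin 16)
  _≟_ = F._≟_ ⊎≟ F._≟_
  crossing : All (λ b → ∀ e → bipartite (b (src e)) (b (tgt e)) ≢ 0) K16,16-blocks
  crossing = toWitness {a? = All.all? (λ b → all? λ e → ¬? (bipartite (b (src e)) (b (tgt e)) ℕ.≟ 0)) K16,16-blocks} tt
  across : ∀ x y → multiplicity _≟_ K16,16-blocks (inj₁ x) (inj₂ y) ≡ 1
  across = toWitness {a? = all? λ x → all? λ y → multiplicity _≟_ K16,16-blocks (inj₁ x) (inj₂ y) ℕ.≟ 1} tt
  exact-K16,16 : ∀ u v → multiplicity _≟_ K16,16-blocks u v ≡ bipartite u v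
  exact-K16,16 (inj₁ x) (inj₂ y) = across x y
  exact-K16,16 (inj₂ x) (inj₁ y) = trans (multiplicity-sym _≟_ K16,16-blocks (inj₂ x) (inj₁ y)) (across y x)
  exact-K16,16 (inj₁ x) (inj₁ y) = multiplicity-off _≟_ bipartite-sym crossing {inj₁ x} {inj₁ y} refl
  exact-K16,16 (inj₂ x) (inj₂ y) = multiplicity-off _≟_ bipartite-sym crossing {inj₂ x} {inj₂ y} refl

Points : ℕ → Set
Points zero    = Fin 0
Points (suc s) = Points s ⊎ Fin 16

_≟ₚ_ : ∀ {s} → DecidableEquality (Points s)
_≟ₚ_ {zero}  = F._≟_
_≟ₚ_ {suc s} = _≟ₚ_ {s} ⊎≟ F._≟_

points↔ : ∀ s → Points s ↔ Fin (s * 16)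
points↔ zero    = ↔-refl
points↔ (suc s) = ↔-trans (points↔ s ⊎-↔ ↔-refl) (↔-trans swap-↔ (↔-sym (+↔⊎ {16} {s * 16})))

bipartite-design : ∀ s → Design (_≟ₚ_ {s} ⊎≟ F._≟_) bipartite
bipartite-design zero    = edgeless λ { (inj₁ ()) _ ; (inj₂ _) (inj₁ ()) ; (inj₂ _) (inj₂ _) → refl }
bipartite-design (suc s) = bipartite-join (_≟ₚ_ {s}) (F._≟_ {16}) (F._≟_ {16}) (bipartite-design s) K16,16-design

cone-design : ∀ s → Design (_≟⊤_ ⊎≟ _≟ₚ_ {s}) (distinct (_≟⊤_ ⊎≟ _≟ₚ_ {s}))
cone-design zero    = edgeless λ { (inj₁ _) (inj₁ _) → refl ; (inj₁ _) (inj₂ ()) ; (inj₂ ()) _ }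
cone-design (suc s) = cone-join (_≟ₚ_ {s}) (F._≟_ {16}) (cone-design s) K17-cone (bipartite-design s)
  where K17-cone : Design (_≟⊤_ ⊎≟ F._≟_) (distinct (_≟⊤_ ⊎≟ F._≟_ {16}))
        K17-cone = complete-transport (↔-trans (+↔⊎ {1} {16}) (1↔⊤ ⊎-↔ ↔-refl)) K17-design

complete-design : ∀ m → m % 16 ≡ 1 → Design F._≟_ (distinct (F._≟_ {m}))
complete-design m m%16≡1 = subst (λ k → Design F._≟_ (distinct (F._≟_ {k}))) (sym m≡1+16q)
  (complete-transport (↔-trans (↔-sym 1↔⊤ ⊎-↔ points↔ q) (↔-sym (+↔⊎ {1} {q * 16}))) (cone-design q))
  where
  q : ℕ
  q = m / 16
  m≡1+16q : m ≡ suc (q * 16)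
  m≡1+16q = trans (m≡m%n+[m/n]*n m 16) (cong (_+ q * 16) m%16≡1)

module _ {A B : Set} (_≟ᴮ_ : DecidableEquality B) where

  private
    row-from : B → A × B → Maybe A
    row-from h₀ (g , h) = if does (h ≟ᴮ h₀) then just g else nothing

  row : B → Embedding A (A × B)
  row h₀ = record
    { to      = λ g → g , h₀
    ; from    = row-from h₀
    ; from-to = λ g → cong (if_then just g else nothing) (dec-true (h₀ ≟ᴮ h₀) refl)
    ; to-from = to-from-row }
    where
    to-from-row : ∀ {u g} → row-from h₀ u ≡ just g → (g , h₀) ≡ u
    to-from-row {_ , h} eq with h ≟ᴮ h₀
    to-from-row {_ , h} refl | yes refl = refl

  row-off : ∀ {h₀ g h} → h ≢ h₀ → from (row h₀) (g , h) ≡ nothing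
  row-off {h₀} {g} {h} h≢h₀ = cong (if_then just g else nothing) (dec-false (h ≟ᴮ h₀) h≢h₀)

transpose : {A B C : Set} → Embedding A (B × C) → Embedding A (C × B)
transpose e = record { to = swap ∘ to e ; from = from e ∘ swap ; from-to = from-to e ; to-from = cong swap ∘ to-from e }

module _ {A : Set} {n : ℕ} (χ : A → A → ℕ) where

  rows-on : ∀ g g' h → ∑[ h₀ < n ] push (row F._≟_ h₀) χ (g , h) (g' , h) ≡ χ g g'
  rows-on g g' h = trans (sum-delta _ h off) (push-to (row F._≟_ h) g g')
    where
    off : ∀ h₀ → h₀ ≢ h → push (row F._≟_ h₀) χ (g , h) (g' , h) ≡ 0
    off h₀ h₀≢h = push-offˡ (row F._≟_ h₀) {χ} {g , h} {g' , h} (row-off F._≟_ (h₀≢h ∘ sym))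

  rows-off : ∀ {g g' h h'} → h ≢ h' → ∑[ h₀ < n ] push (row F._≟_ h₀) χ (g , h) (g' , h') ≡ 0
  rows-off {g} {g'} {h} {h'} h≢h' = sum-zero _ off
    where
    off : ∀ h₀ → push (row F._≟_ h₀) χ (g , h) (g' , h') ≡ 0
    off h₀ = Sum.[ (λ h≡h₀ → push-offʳ (row F._≟_ h₀) {χ} {g , h} {g' , h'} (row-off F._≟_ (λ h'≡h₀ → h≢h' (trans h≡h₀ (sym h'≡h₀)))))
                 , (λ h≢h₀ → push-offˡ (row F._≟_ h₀) {χ} {g , h} {g' , h'} (row-off F._≟_ h≢h₀)) ]′ (toSum (h F.≟ h₀))

module _ {m n : ℕ} where

  _≟ᵍ_ : DecidableEquality (Fin m × Fin n)
  _≟ᵍ_ = F._≟_ ×≟ F._≟_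

  column : Fin m → Embedding (Fin n) (Fin m × Fin n)
  column g₀ = transpose (row F._≟_ g₀)

  grid : Fin m × Fin n → Fin m × Fin n → ℕ
  grid u v = ∑[ h₀ < n ] push (row F._≟_ h₀) (distinct F._≟_) u v + ∑[ g₀ < m ] push (column g₀) (distinct F._≟_) u v

  grid-design : Design F._≟_ (distinct (F._≟_ {m})) → Design F._≟_ (distinct (F._≟_ {n})) → Design _≟ᵍ_ grid
  grid-design DM DN = design-union (design-⋃ λ h₀ → design-image F._≟_ _≟ᵍ_ (row F._≟_ h₀) DM)
                                   (design-⋃ λ g₀ → design-image F._≟_ _≟ᵍ_ (column g₀) DN)

  grid-edges : ∀ u v → Adj (K m □ K n) u v → grid u v ≡ 1
  grid-edges (g , h) (_ , h') (inj₁ (refl , h≢h')) =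
    cong₂ _+_ (rows-off (distinct F._≟_) h≢h')
              (trans (rows-on (distinct F._≟_) h h' g) (indicator-yes (¬? (h F.≟ h')) h≢h'))
  grid-edges (g , h) (g' , _) (inj₂ (refl , g≢g')) =
    cong₂ _+_ (trans (rows-on (distinct F._≟_) g g' h) (indicator-yes (¬? (g F.≟ g')) g≢g'))
              (rows-off (distinct F._≟_) g≢g')

  grid-support : ∀ u v → grid u v ≢ 0 → Adj (K m □ K n) u v
  grid-support u v grid≢0 with +≢0 grid≢0
  ... | inj₁ rows≢0 with sum≢0 _ rows≢0
  ...   | h₀ , term≢0 with push-support (row F._≟_ h₀) {distinct F._≟_} {u} {v} term≢0
  ...     | g , g' , refl , refl , d≢0 = inj₂ (refl , indicator-sound (¬? (g F.≟ g')) d≢0)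
  grid-support u v grid≢0 | inj₂ cols≢0 with sum≢0 _ cols≢0
  ...   | g₀ , term≢0 with push-support (column g₀) {distinct F._≟_} {u} {v} term≢0
  ...     | h , h' , refl , refl , d≢0 = inj₁ (refl , indicator-sound (¬? (h F.≟ h')) d≢0)

module _ {V : Set} {G : Graph V} (_≟_ : DecidableEquality V) {χ : V → V → ℕ} where

  private
    placed⇒edge≢0 : ∀ b e {u v} → PlacesOn b e u v → indicator (places? _≟_ b e u v) ≢ 0
    placed⇒edge≢0 b e {u} {v} p ≡0 = 1+n≢0 (trans (sym (indicator-yes (places? _≟_ b e u v) p)) ≡0)

    placed⇒block≢0 : ∀ b e {u v} → PlacesOn b e u v → blockMultiplicity _≟_ b u v ≢ 0
    placed⇒block≢0 b e {u} {v} p Σ≡0 = placed⇒edge≢0 b e p (sum-zero⁻ (λ ε → indicator (places? _≟_ b ε u v)) Σ≡0 e)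

  decomposition : Design _≟_ χ → (∀ u v → χ u v ≢ 0 → Adj G u v) → (∀ u v → Adj G u v → χ u v ≡ 1) →
                  L8Decomposition G
  decomposition D support on-edges = record { k = length L ; copies = copy ; unique = unique }
    where
    L : List (Block V)
    L = blocks D

    by-position : ∀ u v → multiplicity _≟_ L u v ≡ ∑[ i < length L ] blockMultiplicity _≟_ (lookup L i) u v
    by-position u v = sum-lookup (λ b → blockMultiplicity _≟_ b u v) L

    placed⇒χ≢0 : ∀ i e {u v} → PlacesOn (lookup L i) e u v → χ u v ≢ 0
    placed⇒χ≢0 i e {u} {v} p χ≡0 =
      placed⇒block≢0 (lookup L i) e p (sum-zero⁻ _ (trans (sym (by-position u v)) (trans (exact D u v) χ≡0)) i)

    copy : Fin (length L) → L8Copy G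
    copy i = record
      { vmap  = lookup L i
      ; inj   = λ {x} {y} → All.lookup (injective D) (∈-lookup i) x y
      ; edges = λ e → support _ _ (placed⇒χ≢0 i e (inj₁ (refl , refl))) }

    unique : ∀ u v → Adj G u v → Σ (Fin (length L) × Fin 8) λ p → Covers (copy (Product.proj₁ p)) (Product.proj₂ p) u v
               × (∀ q → Covers (copy (Product.proj₁ q)) (Product.proj₂ q) u v → q ≡ p)
    unique u v adj with single-term _ (trans (sym (by-position u v)) (trans (exact D u v) (on-edges u v adj)))
    ... | i , block-i≡1 , only-i with single-term _ block-i≡1
    ... | e , edge-e≡1 , only-e =
      (i , e) , indicator-sound (places? _≟_ (lookup L i) e u v) (λ ≡0 → 1+n≢0 (trans (sym edge-e≡1) ≡0)) , only
      where
      only : ∀ q → Covers (copy (Product.proj₁ q)) (Product.proj₂ q) u v → q ≡ (i , e)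
      only (i' , e') p with only-i i' (placed⇒block≢0 (lookup L i') e' p)
      ... | refl = cong (i ,_) (only-e e' (placed⇒edge≢0 (lookup L i) e' p))

lemma2p5 : (m n : ℕ) → m % 16 ≡ 1 → n % 16 ≡ 1 →
           L8Decomposition (K m □ K n)
lemma2p5 m n m%16≡1 n%16≡1 =
  decomposition _≟ᵍ_ (grid-design (complete-design m m%16≡1) (complete-design n n%16≡1)) grid-support grid-edges
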